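{- Let $d\geq 0$ be an integer. Every $d$-degenerate graph $G$ satisfies $\operatorname{tww}(G)\leq\sqrt{2d|V(G)|}+2d$.
   Context: All graphs are finite and simple. A graph $G$ is $d$-degenerate if there is a linear order $v_1,\dots,v_n$ of $V(G)$ such that each $v_i$ has at most $d$ neighbors among $v_1,\dots,v_{i-1}$. A trigraph is a graph whose edges are colored red or black; a graph is a trigraph with all edges black. For a partition $\mathcal{P}$ of $V(G)$, the quotient trigraph $G/\mathcal{P}$ has vertex set $\mathcal{P}$; two parts $U,W$ are joined by a black edge if every pair $u\in U,w\in W$ is a black edge, are non-adjacent if no such pair is an edge, and are joined by a red edge otherwise. A contraction sequence of an $n$-vertex trigraph $G$ is a sequence $\mathcal{P}_n,\dots,\mathcal{P}_1$ of partitions of $V(G)$ with $\mathcal{P}_n$ discrete and each $\mathcal{P}_i$ obtained from $\mathcal{P}_{i+1}$ by merging two parts; its width is the maximum red degree over all $G/\mathcal{P}_i$. The twin-width $\operatorname{tww}(G)$ is the minimum width of a contraction sequence. -}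

module Defs where

open import Data.Nat using (ℕ; zero; suc; _+_; _*_; _∸_; _^_; _≤_; _<_)
open import Data.Bool using (Bool; true; false; _∧_; _∨_; not; if_then_else_)
open import Data.Fin using (Fin; toℕ; inject₁) renaming (suc to fsuc; zero to fzero)
open import Data.Fin.Permutation using (Permutation′; _⟨$⟩ʳ_)
open import Data.List using (List; map; allFin)
open import Data.Nat.ListAction using (sum)
open import Data.Bool.ListAction using (any)
open import Data.Product using (Σ; _×_; _,_; ∃)
open import Relation.Binary.PropositionalEquality using (_≡_)
open import Relation.Nullary using (¬_)

record Graph (n : ℕ) : Set where
  field
    adj   : Fin n → Fin n → Bool
    sym   : ∀ x y → adj x y ≡ adj y x
    irrefl : ∀ x → adj x x ≡ false
open Graph public

count : ∀ {n} → (Fin n → Bool) → ℕ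
count {n} p = sum (map (λ x → if p x then 1 else 0) (allFin n))

anyFin : ∀ {n} → (Fin n → Bool) → Bool
anyFin {n} p = any p (allFin n)

Degenerate : ∀ {n} → ℕ → Graph n → Set
Degenerate {n} d G =
  Σ (Permutation′ n) λ rank →
    ∀ v → count (λ u → adj G u v ∧ (toℕ (rank ⟨$⟩ʳ u) Data.Nat.<ᵇ toℕ (rank ⟨$⟩ʳ v))) ≤ d

-- A partition of Fin n, represented by its "same part" relation.
Partition : ℕ → Set
Partition n = Fin n → Fin n → Bool

Discrete : ∀ {n} → Partition n → Set
Discrete {n} P = ∀ (x y : Fin n) → (P x y ≡ true → x ≡ y) × (x ≡ y → P x y ≡ true)

MergeOf : ∀ {n} → Partition n → Partition n → Set
MergeOf {n} P Q =
  Σ (Fin n) λ u → Σ (Fin n) λ v →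
    (P u v ≡ false) ×
    (∀ x y → Q x y ≡ (P x y ∨ (P x u ∧ P y v) ∨ (P x v ∧ P y u)))

-- A contraction sequence P_n, …, P_1 of an n-vertex graph, listed as
-- seq 0 = P_n, seq 1 = P_{n-1}, …, seq (n-1) = P_1.
record ContractionSequence (n : ℕ) : Set where
  field
    seq      : Fin n → Partition n
    discrete : ∀ (i : Fin n) → toℕ i ≡ 0 → Discrete (seq i)
    merges   : ∀ (i : Fin n) (j : Fin n) → suc (toℕ i) ≡ toℕ j → MergeOf (seq i) (seq j)
open ContractionSequence public

redEdge : ∀ {n} → Graph n → Partition n → Fin n → Fin n → Bool
redEdge G P u w =
  not (P u w) ∧
  anyFin (λ a → anyFin (λ b → P u a ∧ P w b ∧ adj G a b)) ∧
  anyFin (λ a → anyFin (λ b → P u a ∧ P w b ∧ not (adj G a b)))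

isRep : ∀ {n} → Partition n → Fin n → Bool
isRep P w = not (anyFin (λ x → P x w ∧ (toℕ x Data.Nat.<ᵇ toℕ w)))

-- red degree of the part containing u in G/P (counting parts via their representatives)
redDeg : ∀ {n} → Graph n → Partition n → Fin n → ℕ
redDeg G P u = count (λ w → isRep P w ∧ redEdge G P u w)

WidthAtMost : ∀ {n} → Graph n → ContractionSequence n → ℕ → Set
WidthAtMost G S k = ∀ i u → redDeg G (seq S i) u ≤ k

TwwAtMost : ∀ {n} → Graph n → ℕ → Set
TwwAtMost {n} G k = Σ (ContractionSequence n) λ S → WidthAtMost G S k

-- Reverse a degeneracy order, so that every vertex has at most d neighbours later in the
-- order, and cut the order into consecutive chunks: d chunks of length m, then d of length
-- m − 1, …, down to d chunks of length 1, where m is least with n ≤ d·m(m+1)/2.  The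
-- contraction sequence first assembles the chunks, one vertex at a time in order, and then
-- merges the finished chunks one after another.  While the chunks are assembled, a red
-- neighbour of the part of chunk j = d·a + b (of length m − a) is either an earlier chunk or
-- contains a later neighbour of one of its members, so there are at most
-- j + d·(m − a) ≤ d·m + d − 1 of them.  Two singletons are never joined by a red edge, so a
-- singleton, like any part in the second phase, has only chunk parts as red neighbours, and
-- there are at most d·m of those.  Finally (d·m + d − 1) − 2·d < d·(m − 1), and minimality of m,
-- d·(m − 1)·m/2 < n, gives (d·(m − 1))² < 2·d·n.
-- A 0-degenerate graph has no edges, so any contraction sequence has width 0.

module Submission where

open import Defs hiding (sym)
open import Data.Nat as ℕ
  using (ℕ; zero; suc; pred; _+_; _*_; _∸_; _^_; _≤_; _<_; z≤n; s≤s; _≡ᵇ_; _≤ᵇ_; _<ᵇ_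
        ; _≤′_; ≤′-refl; ≤′-step)
open import Data.Nat.Properties hiding (_≟_)
open import Data.Nat.Tactic.RingSolver using (solve-∀)
open import Algebra.Properties.CommutativeSemigroup +-commutativeSemigroup using (interchange)
open import Data.Bool using (Bool; true; false; _∧_; _∨_; not; if_then_else_; T)
open import Data.Bool.Properties using (T-∨; T-∧; T?; T-≡; ∧-identityʳ; ∧-zeroʳ; ∨-identityʳ)
open import Data.Fin as Fin using (Fin; toℕ; fromℕ<) renaming (suc to fsuc; zero to fzero)
import Data.Fin.Properties as Finₚ
open import Data.Fin.Permutation using (Permutation′; _⟨$⟩ʳ_; _⟨$⟩ˡ_; inverseˡ; inverseʳ; _∘ₚ_; reverse)
open import Data.List using (_∷_; map; allFin)
open import Data.List.Properties using (map-tabulate; map-cong)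
open import Data.List.Relation.Unary.Any using (satisfied)
open import Data.List.Relation.Unary.Any.Properties using (any⁺; any⁻)
open import Data.List.Membership.Propositional using (lose)
open import Data.List.Membership.Propositional.Properties using (∈-allFin)
open import Data.Nat.ListAction using (sum)
open import Data.Bool.ListAction using (or)
open import Data.Product using (Σ; ∃; ∃₂; _×_; _,_; proj₁; proj₂)
open import Data.Sum using (_⊎_; inj₁; inj₂; map₂)
open import Data.Empty using (⊥-elim)
open import Data.Unit using (tt)
open import Function using (_∘_; id)
open import Function.Bundles using (Equivalence)
open import Relation.Binary.PropositionalEquality
open import Relation.Nullary using (¬_; Dec; yes; no; does)
open import Relation.Binary using (tri<; tri≈; tri>)
open import Relation.Unary using (Decidable)

private
  variable
    n m : ℕ

T-∧-intro : ∀ {a b} → T a → T b → T (a ∧ b)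
T-∧-intro ta tb = Equivalence.from T-∧ (ta , tb)

T-∧-elim : ∀ a {b} → T (a ∧ b) → T a × T b
T-∧-elim _ = Equivalence.to T-∧

T-∧³ : ∀ a b c → T (a ∧ b ∧ c) → T a × T b × T c
T-∧³ true true true _ = tt , tt , tt

T-not⇒¬T : ∀ {b} → T (not b) → ¬ T b
T-not⇒¬T {false} _ ()

≡ᵇ-refl : ∀ a → (a ≡ᵇ a) ≡ true
≡ᵇ-refl a = Equivalence.to T-≡ (≡⇒≡ᵇ a a refl)

≡ᵇ-false : ∀ {a b} → a ≢ b → (a ≡ᵇ b) ≡ false
≡ᵇ-false {a} {b} a≢b = ¬T⇒≡false (a≢b ∘ ≡ᵇ⇒≡ a b)
  where
    ¬T⇒≡false : ∀ {c} → ¬ T c → c ≡ false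
    ¬T⇒≡false {false} _ = refl
    ¬T⇒≡false {true} ¬c = ⊥-elim (¬c tt)

≡ᵇ-sym : ∀ a b → (a ≡ᵇ b) ≡ (b ≡ᵇ a)
≡ᵇ-sym a b with a ℕ.≟ b
... | yes refl = refl
... | no a≢b = trans (≡ᵇ-false a≢b) (sym (≡ᵇ-false (a≢b ∘ sym)))

if-≤ᵇ-yes : ∀ {A : Set} {a b} {x y : A} → a ≤ b → (if a ≤ᵇ b then x else y) ≡ x
if-≤ᵇ-yes {a = a} {b} a≤b with a ≤ᵇ b | ≤⇒≤ᵇ a≤b
... | true | _ = refl

if-≤ᵇ-no : ∀ {A : Set} {a b} {x y : A} → b < a → (if a ≤ᵇ b then x else y) ≡ y
if-≤ᵇ-no {a = a} {b} b<a with a ≤ᵇ b in eq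
... | false = refl
... | true = ⊥-elim (<⇒≱ b<a (≤ᵇ⇒≤ a b (subst T (sym eq) tt)))

<pred⇒suc< : ∀ {m n} → m < pred n → suc m < n
<pred⇒suc< {n = suc n} m<n = s≤s m<n

stepwise-mono : (f : ℕ → ℕ) → (∀ t → f t ≤ f (suc t)) → ∀ {t t′} → t ≤ t′ → f t ≤ f t′
stepwise-mono f f-step t≤t′ = go (≤⇒≤′ t≤t′)
  where
    go : ∀ {t t′} → t ≤′ t′ → f t ≤ f t′
    go ≤′-refl = ≤-refl
    go (≤′-step p) = ≤-trans (go p) (f-step _)

unit-step-crossing : (f : ℕ → ℕ) → f 0 ≡ 0 → (∀ t → f (suc t) ≤ suc (f t)) →
                     ∀ {s} t → s < f t → ∃ λ t₀ → t₀ < t × f t₀ ≡ s × f (suc t₀) ≡ suc s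
unit-step-crossing f f0 unit zero s<f0 = ⊥-elim (n≮0 (subst (_ <_) f0 s<f0))
unit-step-crossing f f0 unit {s} (suc t) s<f with s <? f t
... | yes s<ft with unit-step-crossing f f0 unit t s<ft
...   | t₀ , t₀<t , e₀ , e₁ = t₀ , m<n⇒m<1+n t₀<t , e₀ , e₁
unit-step-crossing f f0 unit {s} (suc t) s<f | no s≮ft =
  t , ≤-refl , ft≡s , ≤-antisym (≤-trans (unit t) (s≤s (≤-reflexive ft≡s))) s<f
  where
    ft≡s : f t ≡ s
    ft≡s = ≤-antisym (≮⇒≥ s≮ft) (≤-pred (≤-trans s<f (unit t)))

descend-to-boundary : {P : ℕ → Set} → Decidable P → ∀ N → P N →
                      ∃ λ m → P m × (m ≡ 0 ⊎ ¬ P (pred m))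
descend-to-boundary P? zero pN = 0 , pN , inj₁ refl
descend-to-boundary P? (suc N) pN with P? N
... | yes pN′ = descend-to-boundary P? N pN′
... | no ¬pN′ = suc N , pN , inj₂ ¬pN′

-- Counting over Fin n

map-allFin-suc : {A : Set} (f : Fin (suc n) → A) → map f (allFin (suc n)) ≡ f fzero ∷ map (f ∘ fsuc) (allFin n)
map-allFin-suc {n} f = cong (f fzero ∷_) (trans (map-tabulate fsuc f) (sym (map-tabulate id (f ∘ fsuc))))

bit : Bool → ℕ
bit b = if b then 1 else 0

bit-mono : ∀ {a b} → (T a → T b) → bit a ≤ bit b
bit-mono {false} _ = z≤n
bit-mono {true} {true} _ = ≤-refl
bit-mono {true} {false} a⇒b = ⊥-elim (a⇒b tt)

bit-∨ : ∀ {a b c} → (T a → T b ⊎ T c) → bit a ≤ bit b + bit c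
bit-∨ {false} _ = z≤n
bit-∨ {true} {true} _ = s≤s z≤n
bit-∨ {true} {false} {true} _ = ≤-refl
bit-∨ {true} {false} {false} a⇒b∨c with a⇒b∨c tt
... | inj₁ ()
... | inj₂ ()

bit-true : ∀ {a} → T a → bit a ≡ 1
bit-true {true} _ = refl

bit-false : ∀ {a} → ¬ T a → bit a ≡ 0
bit-false {false} _ = refl
bit-false {true} ¬a = ⊥-elim (¬a tt)

count-suc : (p : Fin (suc n) → Bool) → count p ≡ bit (p fzero) + count (p ∘ fsuc)
count-suc p = cong sum (map-allFin-suc (bit ∘ p))

anyFin-suc : (p : Fin (suc n) → Bool) → anyFin p ≡ p fzero ∨ anyFin (p ∘ fsuc)
anyFin-suc p = cong or (map-allFin-suc p)

anyFin-intro : {p : Fin n → Bool} (x : Fin n) → T (p x) → T (anyFin p)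
anyFin-intro {p = p} x px = any⁺ p (lose (∈-allFin x) px)

anyFin-witness : {p : Fin n → Bool} → T (anyFin p) → ∃ λ x → T (p x)
anyFin-witness {n} {p} h = satisfied (any⁻ p (allFin n) h)

count-mono : {p q : Fin n → Bool} → (∀ x → T (p x) → T (q x)) → count p ≤ count q
count-mono {zero} _ = z≤n
count-mono {suc n} {p} {q} p⊆q rewrite count-suc p | count-suc q =
  +-mono-≤ (bit-mono (p⊆q fzero)) (count-mono (p⊆q ∘ fsuc))

count-∪ : {p q r : Fin n → Bool} → (∀ x → T (p x) → T (q x) ⊎ T (r x)) → count p ≤ count q + count r
count-∪ {zero} _ = z≤n
count-∪ {suc n} {p} {q} {r} p⊆q∪r rewrite count-suc p | count-suc q | count-suc r =
  ≤-trans (+-mono-≤ (bit-∨ (p⊆q∪r fzero)) (count-∪ (p⊆q∪r ∘ fsuc)))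
          (≤-reflexive (interchange (bit (q fzero)) (bit (r fzero)) _ _))

count-empty : {p : Fin n → Bool} → (∀ x → ¬ T (p x)) → count p ≡ 0
count-empty {zero} _ = refl
count-empty {suc n} {p} empty =
  trans (count-suc p) (cong₂ _+_ (bit-false (empty fzero)) (count-empty (empty ∘ fsuc)))

count-nonempty : {p : Fin n → Bool} (x : Fin n) → T (p x) → 0 < count p
count-nonempty {suc n} {p} fzero px rewrite count-suc p with p fzero
... | true = s≤s z≤n
count-nonempty {suc n} {p} (fsuc x) px rewrite count-suc p =
  ≤-trans (count-nonempty x px) (m≤n+m _ (bit (p fzero)))

count-all : count {n} (λ _ → true) ≡ n
count-all {zero} = refl
count-all {suc n} = trans (count-suc {n} (λ _ → true)) (cong suc (count-all {n}))

count-cong : {p q : Fin n → Bool} → (∀ x → p x ≡ q x) → count p ≡ count q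
count-cong {n} p≗q = cong sum (map-cong (cong bit ∘ p≗q) (allFin n))

_without_ : (Fin n → Bool) → Fin n → Fin n → Bool
(q without y) z = q z ∧ not (does (z Fin.≟ y))

count-remove : {q : Fin n → Bool} (y : Fin n) → T (q y) → count q ≡ suc (count (q without y))
count-remove {suc n} {q} fzero qy = begin
  count q                                     ≡⟨ count-suc q ⟩
  bit (q fzero) + count (q ∘ fsuc)
    ≡⟨ cong₂ _+_ (bit-true qy) (count-cong {q = rest} λ _ → sym (∧-identityʳ _)) ⟩
  suc (count rest)                            ≡⟨ cong (λ b → suc (bit b + count rest)) (sym (∧-zeroʳ _)) ⟩
  suc (bit (q fzero ∧ false) + count rest)    ≡⟨ cong suc (count-suc (q without fzero)) ⟨
  suc (count (q without fzero))               ∎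
  where
    open ≡-Reasoning
    rest : Fin n → Bool
    rest z = q (fsuc z) ∧ true
count-remove {suc n} {q} (fsuc y) qy = begin
  count q                                     ≡⟨ count-suc q ⟩
  bit (q fzero) + count (q ∘ fsuc)            ≡⟨ cong (bit (q fzero) +_) (count-remove y qy) ⟩
  bit (q fzero) + suc (count rest)            ≡⟨ +-suc (bit (q fzero)) (count rest) ⟩
  suc (bit (q fzero) + count rest)            ≡⟨ cong (λ b → suc (bit b + count rest)) (sym (∧-identityʳ _)) ⟩
  suc (bit (q fzero ∧ true) + count rest)     ≡⟨ cong suc (count-suc (q without (fsuc y))) ⟨
  suc (count (q without (fsuc y)))            ∎
  where
    open ≡-Reasoning
    rest : Fin n → Bool
    rest = (q ∘ fsuc) without y

count-injection : {p : Fin n → Bool} {q : Fin m → Bool} (f : ∀ x → T (p x) → Fin m) →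
                  (∀ x px → T (q (f x px))) → (∀ x y px py → f x px ≡ f y py → x ≡ y) →
                  count p ≤ count q
count-injection {zero} _ _ _ = z≤n
count-injection {suc n} {m} {p} {q} f f∈q f-inj = by-first (T? (p fzero))
  where
    f′-inj : ∀ x y px py → f (fsuc x) px ≡ f (fsuc y) py → x ≡ y
    f′-inj x y px py e = Finₚ.suc-injective (f-inj _ _ px py e)

    by-first : Dec (T (p fzero)) → count p ≤ count q
    by-first (no ¬p0) = begin
      count p                          ≡⟨ count-suc p ⟩
      bit (p fzero) + count (p ∘ fsuc) ≡⟨ cong (_+ count (p ∘ fsuc)) (bit-false ¬p0) ⟩
      count (p ∘ fsuc)                 ≤⟨ count-injection (f ∘ fsuc) (f∈q ∘ fsuc) f′-inj ⟩
      count q                          ∎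
      where open ≤-Reasoning
    by-first (yes p0) = begin
      count p                          ≡⟨ count-suc p ⟩
      bit (p fzero) + count (p ∘ fsuc) ≡⟨ cong (_+ count (p ∘ fsuc)) (bit-true p0) ⟩
      suc (count (p ∘ fsuc))           ≤⟨ s≤s (count-injection (f ∘ fsuc) f′∈q′ f′-inj) ⟩
      suc (count q′)                   ≡⟨ count-remove y₀ (f∈q fzero p0) ⟨
      count q                          ∎
      where
        open ≤-Reasoning
        y₀ : Fin m
        y₀ = f fzero p0
        q′ : Fin m → Bool
        q′ = q without y₀
        f′∈q′ : ∀ x px → T (q′ (f (fsuc x) px))
        f′∈q′ x px with f (fsuc x) px Fin.≟ y₀ | f∈q (fsuc x) px
        ... | yes e | _ with () ← f-inj _ _ px p0 e
        ... | no _  | qfx = T-∧-intro qfx tt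

count-below : {p : Fin n → Bool} (f : Fin n → ℕ) {M : ℕ} → (∀ x → T (p x) → f x < M) →
              (∀ x y → T (p x) → T (p y) → f x ≡ f y → x ≡ y) → count p ≤ M
count-below {p = p} f {M} f<M f-inj = subst (count p ≤_) count-all
  (count-injection (λ x px → fromℕ< (f<M x px)) (λ _ _ → tt)
    (λ x y px py e → f-inj x y px py (begin
      f x                       ≡⟨ Finₚ.toℕ-fromℕ< (f<M x px) ⟨
      toℕ (fromℕ< (f<M x px))  ≡⟨ cong toℕ e ⟩
      toℕ (fromℕ< (f<M y py))  ≡⟨ Finₚ.toℕ-fromℕ< (f<M y py) ⟩
      f y                       ∎)))
  where open ≡-Reasoning

count-⋃ : {k : ℕ} {g : Fin k → Fin n → Bool} {p : Fin k → Bool} (d : ℕ) →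
          (∀ a → count (g a) ≤ d) → (∀ a b → T (g a b) → T (p a)) →
          count (λ b → anyFin (λ a → g a b)) ≤ d * count p
count-⋃ {k = zero} {g} d _ _ =
  ≤-trans (≤-reflexive (count-empty {p = λ b → anyFin (λ a → g a b)} (λ _ ()))) z≤n
count-⋃ {k = suc k} {g} {p} d g≤d g⊆p = begin
  count (λ b → anyFin (λ a → g a b))             ≤⟨ count-∪ split ⟩
  count (g fzero) + count (λ b → anyFin (λ a → g (fsuc a) b))
                                                 ≤⟨ +-mono-≤ first (count-⋃ d (g≤d ∘ fsuc) (g⊆p ∘ fsuc)) ⟩
  d * bit (p fzero) + d * count (p ∘ fsuc)       ≡⟨ *-distribˡ-+ d _ _ ⟨
  d * (bit (p fzero) + count (p ∘ fsuc))         ≡⟨ cong (d *_) (count-suc p) ⟨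
  d * count p                                    ∎
  where
    open ≤-Reasoning
    split : ∀ b → T (anyFin (λ a → g a b)) → T (g fzero b) ⊎ T (anyFin (λ a → g (fsuc a) b))
    split b h = Equivalence.to T-∨ (subst T (anyFin-suc (λ a → g a b)) h)
    first : count (g fzero) ≤ d * bit (p fzero)
    first with T? (p fzero)
    ... | yes p0 = ≤-trans (g≤d fzero) (≤-reflexive (trans (sym (*-identityʳ d)) (cong (d *_) (sym (bit-true p0)))))
    ... | no ¬p0 = ≤-trans (≤-reflexive (count-empty (λ b h → ¬p0 (g⊆p fzero b h)))) z≤n

-- Partitions given by labels

sameLabel : (Fin n → ℕ) → Partition n
sameLabel ℓ x y = ℓ x ≡ᵇ ℓ y

module _ (ℓ : Fin n → ℕ) {x y : Fin n} where

  sameLabel⇒≡ : T (sameLabel ℓ x y) → ℓ x ≡ ℓ y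
  sameLabel⇒≡ = ≡ᵇ⇒≡ (ℓ x) (ℓ y)

  ≡⇒sameLabel : ℓ x ≡ ℓ y → T (sameLabel ℓ x y)
  ≡⇒sameLabel = ≡⇒≡ᵇ (ℓ x) (ℓ y)

sameLabel-discrete : {ℓ : Fin n → ℕ} → (∀ x y → ℓ x ≡ ℓ y → x ≡ y) → Discrete (sameLabel ℓ)
sameLabel-discrete {ℓ = ℓ} ℓ-inj x y =
  (λ e → ℓ-inj x y (sameLabel⇒≡ ℓ (Equivalence.from T-≡ e))) , (λ { refl → ≡ᵇ-refl (ℓ x) })

relabel-merge : (ℓ ℓ′ : Fin n → ℕ) (u v : Fin n) → ℓ u ≢ ℓ v →
                (∀ x → ℓ x ≡ ℓ v → ℓ′ x ≡ ℓ u) → (∀ x → ℓ x ≢ ℓ v → ℓ′ x ≡ ℓ x) →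
                MergeOf (sameLabel ℓ) (sameLabel ℓ′)
relabel-merge ℓ ℓ′ u v u≢v into-u keep = u , v , ≡ᵇ-false u≢v , merged
  where
    U V : ℕ
    U = ℓ u
    V = ℓ v
    merged : ∀ x y → (ℓ′ x ≡ᵇ ℓ′ y) ≡
                     ((ℓ x ≡ᵇ ℓ y) ∨ ((ℓ x ≡ᵇ U) ∧ (ℓ y ≡ᵇ V)) ∨ ((ℓ x ≡ᵇ V) ∧ (ℓ y ≡ᵇ U)))
    merged x y with ℓ x ℕ.≟ V | ℓ y ℕ.≟ V
    ... | yes x∈v | yes y∈v
      rewrite into-u x x∈v | into-u y y∈v | x∈v | y∈v | ≡ᵇ-refl U | ≡ᵇ-refl V = refl
    ... | yes x∈v | no y∉v
      rewrite into-u x x∈v | keep y y∉v | x∈v | ≡ᵇ-false (y∉v ∘ sym) | ≡ᵇ-false (u≢v ∘ sym) | ≡ᵇ-refl V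
      = ≡ᵇ-sym U (ℓ y)
    ... | no x∉v | yes y∈v
      rewrite keep x x∉v | into-u y y∈v | y∈v | ≡ᵇ-false x∉v | ≡ᵇ-refl V
      = sym (trans (∨-identityʳ _) (∧-identityʳ (ℓ x ≡ᵇ U)))
    ... | no x∉v | no y∉v
      rewrite keep x x∉v | keep y y∉v | ≡ᵇ-false x∉v | ≡ᵇ-false y∉v | ∧-zeroʳ (ℓ x ≡ᵇ U)
      = sym (∨-identityʳ (ℓ x ≡ᵇ ℓ y))

rep-minimal : {P : Partition n} {w x : Fin n} → T (isRep P w) → T (P x w) → ¬ (toℕ x < toℕ w)
rep-minimal {x = x} rep x∈w x<w = T-not⇒¬T rep (anyFin-intro x (T-∧-intro x∈w (<⇒<ᵇ x<w)))

sameLabel-rep-unique : {ℓ : Fin n → ℕ} {w w′ : Fin n} →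
                       T (isRep (sameLabel ℓ) w) → T (isRep (sameLabel ℓ) w′) → ℓ w ≡ ℓ w′ → w ≡ w′
sameLabel-rep-unique {ℓ = ℓ} {w} {w′} rep rep′ e with <-cmp (toℕ w) (toℕ w′)
... | tri< w<w′ _ _ = ⊥-elim (rep-minimal {P = sameLabel ℓ} rep′ (≡⇒sameLabel ℓ e) w<w′)
... | tri≈ _ w≡w′ _ = Finₚ.toℕ-injective w≡w′
... | tri> _ _ w′<w = ⊥-elim (rep-minimal {P = sameLabel ℓ} rep (≡⇒sameLabel ℓ (sym e)) w′<w)

-- Red edges

module _ (G : Graph n) (P : Partition n) {u w : Fin n} (red : T (redEdge G P u w)) where

  private
    crossing : (Bool → Bool) → Bool
    crossing f = anyFin (λ a → anyFin (λ b → P u a ∧ P w b ∧ f (adj G a b)))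

    parts : T (not (P u w)) × T (crossing id) × T (crossing not)
    parts = T-∧³ (not (P u w)) (crossing id) (crossing not) red

    witness : (f : Bool → Bool) → T (crossing f) → ∃₂ λ a b → T (P u a) × T (P w b) × T (f (adj G a b))
    witness f cross with anyFin-witness cross
    ... | a , from-a with anyFin-witness from-a
    ... | b , ab = a , b , T-∧³ (P u a) (P w b) (f (adj G a b)) ab

  redEdge-apart : ¬ T (P u w)
  redEdge-apart = T-not⇒¬T (proj₁ parts)

  redEdge-edge : ∃₂ λ a b → T (P u a) × T (P w b) × T (adj G a b)
  redEdge-edge = witness id (proj₁ (proj₂ parts))

  redEdge-non-edge : ∃₂ λ a b → T (P u a) × T (P w b) × ¬ T (adj G a b)
  redEdge-non-edge with witness not (proj₂ (proj₂ parts))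
  ... | a , b , ua , wb , nab = a , b , ua , wb , T-not⇒¬T nab

singletons-not-red : (G : Graph n) (P : Partition n) {u w : Fin n} →
                     (∀ a → T (P u a) → a ≡ u) → (∀ b → T (P w b) → b ≡ w) → ¬ T (redEdge G P u w)
singletons-not-red G P only-u only-w red
  with redEdge-edge G P red | redEdge-non-edge G P red
... | a , b , ua , wb , ab | a′ , b′ , ua′ , wb′ , ¬a′b′
  rewrite only-u a ua | only-w b wb | only-u a′ ua′ | only-w b′ wb′ = ¬a′b′ ab

edgeless-width : (G : Graph n) → (∀ a b → ¬ T (adj G a b)) → ∀ S → WidthAtMost G S 0
edgeless-width {n} G no-edge S i u = ≤-reflexive (count-empty not-red)
  where
    P : Partition n
    P = seq S i
    not-red : ∀ w → ¬ T (isRep P w ∧ redEdge G P u w)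
    not-red w h with redEdge-edge G P (proj₂ (T-∧-elim (isRep P w) h))
    ... | a , b , _ , _ , ab = no-edge a b ab

-- Vertex orders

rank : Permutation′ n → Fin n → ℕ
rank σ x = toℕ (σ ⟨$⟩ʳ x)

rank-injective : (σ : Permutation′ n) {x y : Fin n} → rank σ x ≡ rank σ y → x ≡ y
rank-injective σ {x} {y} e = begin
  x                      ≡⟨ inverseˡ σ ⟨
  σ ⟨$⟩ˡ (σ ⟨$⟩ʳ x)      ≡⟨ cong (σ ⟨$⟩ˡ_) (Finₚ.toℕ-injective e) ⟩
  σ ⟨$⟩ˡ (σ ⟨$⟩ʳ y)      ≡⟨ inverseˡ σ ⟩
  y                      ∎
  where open ≡-Reasoning

LaterDegreeAtMost : Graph n → Permutation′ n → ℕ → Set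
LaterDegreeAtMost G σ d = ∀ v → count (λ u → adj G u v ∧ (rank σ v <ᵇ rank σ u)) ≤ d

reverse-later-degree : ∀ {d} (G : Graph n) (π : Permutation′ n) →
                       (∀ v → count (λ u → adj G u v ∧ (rank π u <ᵇ rank π v)) ≤ d) →
                       LaterDegreeAtMost G (π ∘ₚ reverse) d
reverse-later-degree {n} G π deg v = ≤-trans (count-mono earlier) (deg v)
  where
    reversed : ∀ x → rank (π ∘ₚ reverse) x ≡ n ∸ suc (rank π x)
    reversed x = Finₚ.opposite-prop (π ⟨$⟩ʳ x)
    earlier : ∀ u → T (adj G u v ∧ (rank (π ∘ₚ reverse) v <ᵇ rank (π ∘ₚ reverse) u)) →
                    T (adj G u v ∧ (rank π u <ᵇ rank π v))
    earlier u h with T-∧-elim (adj G u v) h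
    ... | uv , later = T-∧-intro uv (<⇒<ᵇ (≤-pred (∸-cancelʳ-< {suc (rank π v)} {suc (rank π u)} {n}
                         (subst₂ _<_ (reversed v) (reversed u) (<ᵇ⇒< _ _ later)))))

degenerate-0⇒edgeless : (G : Graph n) → Degenerate 0 G → ∀ a b → ¬ T (adj G a b)
degenerate-0⇒edgeless G (π , deg) = no-edge
  where
    earlier-neighbour : ∀ {x y} → rank π x < rank π y → ¬ T (adj G x y)
    earlier-neighbour {x} {y} x<y xy = <⇒≱ (count-nonempty x (T-∧-intro xy (<⇒<ᵇ x<y))) (deg y)
    no-edge : ∀ a b → ¬ T (adj G a b)
    no-edge a b ab with <-cmp (rank π a) (rank π b)
    ... | tri< a<b _ _ = earlier-neighbour a<b ab
    ... | tri≈ _ a≡b _ = subst T (trans (cong (adj G a) (sym (rank-injective π a≡b))) (Graph.irrefl G a)) ab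
    ... | tri> _ _ b<a = earlier-neighbour b<a (subst T (Graph.sym G a b) ab)

-- Chunkings

record Chunking : Set where
  field
    chunk offset : ℕ → ℕ
    chunk-zero  : chunk 0 ≡ 0
    offset-zero : offset 0 ≡ 0
    step        : ∀ t → (chunk (suc t) ≡ suc (chunk t) × offset (suc t) ≡ 0)
                      ⊎ (chunk (suc t) ≡ chunk t × offset (suc t) ≡ suc (offset t))

  chunkStart : ℕ → ℕ
  chunkStart t = t ∸ offset t

  -- The number of positions among 1 … t that do not start a chunk; while the chunks are
  -- assembled, the vertex at position t joins the part of its chunk at step `stage t`.
  stage : ℕ → ℕ
  stage t = t ∸ chunk t

  chunk+offset≤ : ∀ t → chunk t + offset t ≤ t
  chunk+offset≤ zero = ≤-reflexive (cong₂ _+_ chunk-zero offset-zero)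
  chunk+offset≤ (suc t) with step t
  ... | inj₁ (c′ , o′) rewrite c′ | o′ =
    s≤s (≤-trans (≤-reflexive (+-identityʳ (chunk t))) (≤-trans (m≤m+n _ _) (chunk+offset≤ t)))
  ... | inj₂ (c′ , o′) rewrite c′ | o′ | +-suc (chunk t) (offset t) = s≤s (chunk+offset≤ t)

  chunk≤ : ∀ t → chunk t ≤ t
  chunk≤ t = ≤-trans (m≤m+n _ _) (chunk+offset≤ t)

  chunk≤chunkStart : ∀ t → chunk t ≤ chunkStart t
  chunk≤chunkStart t =
    ≤-trans (≤-reflexive (sym (m+n∸n≡m (chunk t) (offset t)))) (∸-monoˡ-≤ (offset t) (chunk+offset≤ t))

  chunkStart≤ : ∀ t → chunkStart t ≤ t
  chunkStart≤ t = m∸n≤m t (offset t)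

  chunk-step : ∀ t → chunk t ≤ chunk (suc t)
  chunk-step t with step t
  ... | inj₁ (c′ , _) = ≤-trans (n≤1+n _) (≤-reflexive (sym c′))
  ... | inj₂ (c′ , _) = ≤-reflexive (sym c′)

  chunk-mono : ∀ {t t′} → t ≤ t′ → chunk t ≤ chunk t′
  chunk-mono = stepwise-mono chunk chunk-step

  stage-new : ∀ {t} → chunk (suc t) ≡ suc (chunk t) → stage (suc t) ≡ stage t
  stage-new {t} c′ = cong (suc t ∸_) c′

  stage-same : ∀ {t} → chunk (suc t) ≡ chunk t → stage (suc t) ≡ suc (stage t)
  stage-same {t} c′ = trans (cong (suc t ∸_) c′) (+-∸-assoc 1 (chunk≤ t))

  stage-step : ∀ t → stage t ≤ stage (suc t)
  stage-step t with step t
  ... | inj₁ (c′ , _) = ≤-reflexive (sym (stage-new c′))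
  ... | inj₂ (c′ , _) = ≤-trans (n≤1+n _) (≤-reflexive (sym (stage-same c′)))

  stage-mono : ∀ {t t′} → t ≤ t′ → stage t ≤ stage t′
  stage-mono = stepwise-mono stage stage-step

  stage<⇒< : ∀ {t t′} → stage t < stage t′ → t < t′
  stage<⇒< s< = ≰⇒> (λ t′≤t → <⇒≱ s< (stage-mono t′≤t))

  stage-zero : stage 0 ≡ 0
  stage-zero = 0∸n≡0 (chunk 0)

  chunk-unit : ∀ t → chunk (suc t) ≤ suc (chunk t)
  chunk-unit t with step t
  ... | inj₁ (c′ , _) = ≤-reflexive c′
  ... | inj₂ (c′ , _) = ≤-trans (≤-reflexive c′) (n≤1+n _)

  stage-unit : ∀ t → stage (suc t) ≤ suc (stage t)
  stage-unit t with step t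
  ... | inj₁ (c′ , _) = ≤-trans (≤-reflexive (stage-new c′)) (n≤1+n _)
  ... | inj₂ (c′ , _) = ≤-reflexive (stage-same c′)

  chunk-crossing : ∀ {k} t → k < chunk t → ∃ λ t₀ → t₀ < t × chunk (suc t₀) ≡ suc k
  chunk-crossing t k<c with unit-step-crossing chunk chunk-zero chunk-unit t k<c
  ... | t₀ , t₀<t , _ , c′ = t₀ , t₀<t , c′

  stage-crossing : ∀ {s} t → s < stage t → ∃ λ t₀ → t₀ < t × stage t₀ ≡ s × stage (suc t₀) ≡ suc s
  stage-crossing = unit-step-crossing stage stage-zero stage-unit

  stage-growth⇒same-chunk : ∀ {t} → stage (suc t) ≡ suc (stage t) → chunk (suc t) ≡ chunk t
  stage-growth⇒same-chunk {t} growth with step t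
  ... | inj₁ (c′ , _) = ⊥-elim (1+n≢n (trans (sym growth) (stage-new c′)))
  ... | inj₂ (c′ , _) = c′

  stage-stall⇒offset-zero : ∀ {t t′} → t < t′ → stage t ≡ stage t′ → offset t′ ≡ 0
  stage-stall⇒offset-zero {t} {suc t′} (s≤s t≤t′) stall with step t′
  ... | inj₁ (_ , o′) = o′
  ... | inj₂ (c′ , _) = ⊥-elim (<-irrefl stall (begin-strict
    stage t         ≤⟨ stage-mono t≤t′ ⟩
    stage t′        <⟨ n<1+n _ ⟩
    suc (stage t′)  ≡⟨ stage-same c′ ⟨
    stage (suc t′)  ∎))
    where open ≤-Reasoning

  stage-zero⇒offset-zero : ∀ t → stage t ≡ 0 → offset t ≡ 0
  stage-zero⇒offset-zero zero _ = offset-zero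
  stage-zero⇒offset-zero (suc t) s≡0 = stage-stall⇒offset-zero (s≤s z≤n) (trans stage-zero (sym s≡0))

  same-chunk-or-later-start : ∀ {t t′} → t ≤′ t′ → (chunk t ≡ chunk t′ × chunkStart t ≡ chunkStart t′)
                                                 ⊎ (chunk t < chunk t′ × t < chunkStart t′)
  same-chunk-or-later-start ≤′-refl = inj₁ (refl , refl)
  same-chunk-or-later-start {t} {suc t′} (≤′-step t≤t′) with step t′ | same-chunk-or-later-start t≤t′
  ... | inj₁ (c′ , o′) | _ = inj₂ (≤-trans (s≤s (chunk-mono (≤′⇒≤ t≤t′))) (≤-reflexive (sym c′)) ,
                                  ≤-trans (s≤s (≤′⇒≤ t≤t′)) (≤-reflexive (sym (cong (suc t′ ∸_) o′))))
  ... | inj₂ (c′ , o′) | ih rewrite c′ | o′ = ih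

  same-chunk⇒same-start : ∀ {t t′} → chunk t ≡ chunk t′ → chunkStart t ≡ chunkStart t′
  same-chunk⇒same-start {t} {t′} c≡ with ≤-total t t′
  ... | inj₁ t≤t′ with same-chunk-or-later-start (≤⇒≤′ t≤t′)
  ...   | inj₁ (_ , s≡) = s≡
  ...   | inj₂ (c< , _) = ⊥-elim (<-irrefl c≡ c<)
  same-chunk⇒same-start {t} {t′} c≡ | inj₂ t′≤t with same-chunk-or-later-start (≤⇒≤′ t′≤t)
  ...   | inj₁ (_ , s≡) = sym s≡
  ...   | inj₂ (c< , _) = ⊥-elim (<-irrefl (sym c≡) c<)

  chunk<⇒start< : ∀ {t t′} → chunk t < chunk t′ → chunkStart t < chunkStart t′
  chunk<⇒start< {t} {t′} c< with ≤-total t t′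
  ... | inj₂ t′≤t = ⊥-elim (<⇒≱ c< (chunk-mono t′≤t))
  ... | inj₁ t≤t′ with same-chunk-or-later-start (≤⇒≤′ t≤t′)
  ...   | inj₁ (c≡ , _) = ⊥-elim (<-irrefl c≡ c<)
  ...   | inj₂ (_ , t<s) = ≤-<-trans (chunkStart≤ t) t<s

  same-start⇒same-chunk : ∀ {t t′} → chunkStart t ≡ chunkStart t′ → chunk t ≡ chunk t′
  same-start⇒same-chunk {t} {t′} s≡ with <-cmp (chunk t) (chunk t′)
  ... | tri< c< _ _ = ⊥-elim (<-irrefl s≡ (chunk<⇒start< c<))
  ... | tri≈ _ c≡ _ = c≡
  ... | tri> _ _ c> = ⊥-elim (<-irrefl (sym s≡) (chunk<⇒start< c>))

  offset-injective : ∀ {t t′} → chunk t ≡ chunk t′ → offset t ≡ offset t′ → t ≡ t′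
  offset-injective {t} {t′} c≡ o≡ = begin
    t                          ≡⟨ m∸n+n≡m (offset≤ t) ⟨
    chunkStart t + offset t    ≡⟨ cong₂ _+_ (same-chunk⇒same-start c≡) o≡ ⟩
    chunkStart t′ + offset t′  ≡⟨ m∸n+n≡m (offset≤ t′) ⟩
    t′                         ∎
    where
      open ≡-Reasoning
      offset≤ : ∀ t → offset t ≤ t
      offset≤ t = ≤-trans (m≤n+m _ _) (chunk+offset≤ t)

singletonChunking : Chunking
singletonChunking = record
  { chunk = id ; offset = λ _ → 0 ; chunk-zero = refl ; offset-zero = refl ; step = λ _ → inj₁ (refl , refl) }

-- The contraction sequence of a chunking

module Contraction {n : ℕ} (σ : Permutation′ n) (C : Chunking) where
  open Chunking C

  τ : Fin n → ℕ
  τ = rank σ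

  τ<n : ∀ x → τ x < n
  τ<n x = Finₚ.toℕ<n (σ ⟨$⟩ʳ x)

  τ-injective : ∀ {x y} → τ x ≡ τ y → x ≡ y
  τ-injective = rank-injective σ

  vertexAt : ∀ {t} → t < n → Fin n
  vertexAt t<n = σ ⟨$⟩ˡ fromℕ< t<n

  τ-vertexAt : ∀ {t} (t<n : t < n) → τ (vertexAt t<n) ≡ t
  τ-vertexAt t<n = trans (cong toℕ (inverseʳ σ)) (Finₚ.toℕ-fromℕ< t<n)

  phase₁ : ℕ
  phase₁ = stage (pred n)

  -- Up to step phase₁ a vertex that has joined carries the label `chunkStart` of its chunk and
  -- every other vertex is a singleton labelled by its position; step phase₁ + k has merged
  -- chunks 0 … k into the part labelled 0.
  mergedLabel : ℕ → ℕ → ℕ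
  mergedLabel k t = if chunk t ≤ᵇ k then 0 else chunkStart t

  label : ℕ → Fin n → ℕ
  label i x = if stage (τ x) ≤ᵇ i then mergedLabel (i ∸ phase₁) (τ x) else τ x

  partition : ℕ → Partition n
  partition i = sameLabel (label i)

  module _ {k t : ℕ} where

    mergedLabel-in : chunk t ≤ k → mergedLabel k t ≡ 0
    mergedLabel-in = if-≤ᵇ-yes

    mergedLabel-out : k < chunk t → mergedLabel k t ≡ chunkStart t
    mergedLabel-out = if-≤ᵇ-no

  mergedLabel-zero : ∀ t → mergedLabel 0 t ≡ chunkStart t
  mergedLabel-zero t with chunk t ≤? 0
  ... | no c≰0 = mergedLabel-out (≰⇒> c≰0)
  ... | yes c≤0 = begin
    mergedLabel 0 t  ≡⟨ mergedLabel-in c≤0 ⟩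
    0                ≡⟨ 0∸n≡0 (offset 0) ⟨
    chunkStart 0     ≡⟨ same-chunk⇒same-start (trans chunk-zero (sym (n≤0⇒n≡0 c≤0))) ⟩
    chunkStart t     ∎
    where open ≡-Reasoning

  mergedLabel≤chunkStart : ∀ k t → mergedLabel k t ≤ chunkStart t
  mergedLabel≤chunkStart k t with chunk t ≤? k
  ... | yes c≤k = ≤-trans (≤-reflexive (mergedLabel-in c≤k)) z≤n
  ... | no c≰k = ≤-reflexive (mergedLabel-out (≰⇒> c≰k))

  mergedLabel-cong : ∀ k {t t′} → chunk t ≡ chunk t′ → mergedLabel k t ≡ mergedLabel k t′
  mergedLabel-cong k c≡ = cong₂ (λ c s → if c ≤ᵇ k then 0 else s) c≡ (same-chunk⇒same-start c≡)

  module _ {i : ℕ} {x : Fin n} where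

    label-joined : stage (τ x) ≤ i → label i x ≡ mergedLabel (i ∸ phase₁) (τ x)
    label-joined = if-≤ᵇ-yes

    label-pending : i < stage (τ x) → label i x ≡ τ x
    label-pending = if-≤ᵇ-no

    label-phase₁ : i ≤ phase₁ → stage (τ x) ≤ i → label i x ≡ chunkStart (τ x)
    label-phase₁ i≤phase₁ joined = begin
      label i x                       ≡⟨ label-joined joined ⟩
      mergedLabel (i ∸ phase₁) (τ x)  ≡⟨ cong (λ k → mergedLabel k (τ x)) (m≤n⇒m∸n≡0 i≤phase₁) ⟩
      mergedLabel 0 (τ x)             ≡⟨ mergedLabel-zero (τ x) ⟩
      chunkStart (τ x)                ∎
      where open ≡-Reasoning

  joined-in-phase₂ : ∀ {i} x → phase₁ ≤ i → stage (τ x) ≤ i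
  joined-in-phase₂ x phase₁≤i = ≤-trans (stage-mono (suc[m]≤n⇒m≤pred[n] (τ<n x))) phase₁≤i

  joined<pending : ∀ {i x y} → stage (τ x) ≤ i → i < stage (τ y) → label i x < label i y
  joined<pending {i} {x} {y} joined pending = begin-strict
    label i x                       ≡⟨ label-joined joined ⟩
    mergedLabel (i ∸ phase₁) (τ x)  ≤⟨ mergedLabel≤chunkStart _ (τ x) ⟩
    chunkStart (τ x)                ≤⟨ chunkStart≤ (τ x) ⟩
    τ x                             <⟨ stage<⇒< (≤-<-trans joined pending) ⟩
    τ y                             ≡⟨ label-pending pending ⟨
    label i y                       ∎
    where open ≤-Reasoning

  pending-singleton : ∀ {i x y} → i < stage (τ y) → label i x ≡ label i y → x ≡ y
  pending-singleton {i} {x} {y} pending same with stage (τ x) ≤? i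
  ... | yes joined = ⊥-elim (<-irrefl same (joined<pending joined pending))
  ... | no x-pending = τ-injective (begin
    τ x        ≡⟨ label-pending (≰⇒> x-pending) ⟨
    label i x  ≡⟨ same ⟩
    label i y  ≡⟨ label-pending pending ⟩
    τ y        ∎)
    where open ≡-Reasoning

  joined-closed : ∀ {i x y} → stage (τ x) ≤ i → label i x ≡ label i y → stage (τ y) ≤ i
  joined-closed {i} {x} {y} joined same with stage (τ y) ≤? i
  ... | yes y-joined = y-joined
  ... | no y-pending = ⊥-elim (<-irrefl same (joined<pending joined (≰⇒> y-pending)))

  same-chunk⇒same-label : ∀ {i x y} → stage (τ x) ≤ i → stage (τ y) ≤ i →
                          chunk (τ x) ≡ chunk (τ y) → label i x ≡ label i y
  same-chunk⇒same-label {i} jx jy c≡ =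
    trans (label-joined jx) (trans (mergedLabel-cong (i ∸ phase₁) c≡) (sym (label-joined jy)))

  same-label⇒same-chunk : ∀ {i x y} → i ≤ phase₁ → stage (τ x) ≤ i → stage (τ y) ≤ i →
                          label i x ≡ label i y → chunk (τ x) ≡ chunk (τ y)
  same-label⇒same-chunk i≤phase₁ jx jy same =
    same-start⇒same-chunk (trans (sym (label-phase₁ i≤phase₁ jx)) (trans same (label-phase₁ i≤phase₁ jy)))

  label-zero : ∀ x → label 0 x ≡ τ x
  label-zero x with stage (τ x) ≤? 0
  ... | no pending = label-pending (≰⇒> pending)
  ... | yes joined = begin
    label 0 x              ≡⟨ label-phase₁ z≤n joined ⟩
    τ x ∸ offset (τ x)     ≡⟨ cong (τ x ∸_) (stage-zero⇒offset-zero (τ x) (n≤0⇒n≡0 joined)) ⟩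
    τ x                    ∎
    where open ≡-Reasoning

  phase₁-step : ∀ {i t₀ x} → suc i ≤ phase₁ → stage t₀ ≡ i → stage (suc t₀) ≡ suc i →
                τ x ≢ suc t₀ → label (suc i) x ≡ label i x
  phase₁-step {i} {t₀} {x} i<phase₁ stage-t₀ stage-t₁ τx≢t₁ with <-cmp (stage (τ x)) (suc i)
  ... | tri< joined _ _ =
    trans (label-phase₁ i<phase₁ (≤-trans (≤-pred joined) (n≤1+n i)))
          (sym (label-phase₁ (<⇒≤ i<phase₁) (≤-pred joined)))
  ... | tri> _ _ pending = trans (label-pending pending) (sym (label-pending (<-trans (n<1+n i) pending)))
  -- x joins now but lies beyond position suc t₀ at the same stage, so it starts its own chunk.
  ... | tri≈ _ joins _ = begin
    label (suc i) x        ≡⟨ label-phase₁ i<phase₁ (≤-reflexive joins) ⟩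
    τ x ∸ offset (τ x)     ≡⟨ cong (τ x ∸_) (stage-stall⇒offset-zero t₁<τx (trans stage-t₁ (sym joins))) ⟩
    τ x                    ≡⟨ label-pending (≤-reflexive (sym joins)) ⟨
    label i x              ∎
    where
      open ≡-Reasoning
      t₁<τx : suc t₀ < τ x
      t₁<τx with <-cmp (suc t₀) (τ x)
      ... | tri< t₁<τx _ _ = t₁<τx
      ... | tri≈ _ t₁≡τx _ = ⊥-elim (τx≢t₁ (sym t₁≡τx))
      ... | tri> _ _ (s≤s τx≤t₀) =
        ⊥-elim (1+n≰n (subst (_≤ i) joins (≤-trans (stage-mono τx≤t₀) (≤-reflexive stage-t₀))))

  phase₁-merge : ∀ i → suc i ≤ phase₁ → MergeOf (partition i) (partition (suc i))
  phase₁-merge i i<phase₁ with stage-crossing (pred n) i<phase₁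
  ... | t₀ , t₀<n-1 , stage-t₀ , stage-t₁ = relabel-merge (label i) (label (suc i)) u v u≢v into-u keep
    where
      t₁<n : suc t₀ < n
      t₁<n = <pred⇒suc< t₀<n-1
      t₀<n : t₀ < n
      t₀<n = <-trans (n<1+n t₀) t₁<n
      u v : Fin n
      u = vertexAt t₀<n
      v = vertexAt t₁<n
      stage-v : stage (τ v) ≡ suc i
      stage-v = trans (cong stage (τ-vertexAt t₁<n)) stage-t₁
      label-u : label i u ≡ chunkStart t₀
      label-u = trans (label-phase₁ (<⇒≤ i<phase₁) (≤-reflexive (trans (cong stage (τ-vertexAt t₀<n)) stage-t₀)))
                      (cong chunkStart (τ-vertexAt t₀<n))
      label-v : label i v ≡ suc t₀
      label-v = trans (label-pending (≤-reflexive (sym stage-v))) (τ-vertexAt t₁<n)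
      u≢v : label i u ≢ label i v
      u≢v same = <-irrefl (trans (sym label-u) (trans same label-v)) (s≤s (chunkStart≤ t₀))
      into-u : ∀ x → label i x ≡ label i v → label (suc i) x ≡ label i u
      into-u x same with pending-singleton (≤-reflexive (sym stage-v)) same
      ... | refl = begin
        label (suc i) v        ≡⟨ label-phase₁ i<phase₁ (≤-reflexive stage-v) ⟩
        chunkStart (τ v)       ≡⟨ cong chunkStart (τ-vertexAt t₁<n) ⟩
        chunkStart (suc t₀)    ≡⟨ same-chunk⇒same-start (stage-growth⇒same-chunk grows) ⟩
        chunkStart t₀          ≡⟨ label-u ⟨
        label i u              ∎
        where
          open ≡-Reasoning
          grows : stage (suc t₀) ≡ suc (stage t₀)
          grows = trans stage-t₁ (cong suc (sym stage-t₀))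
      keep : ∀ x → label i x ≢ label i v → label (suc i) x ≡ label i x
      keep x x≢v = phase₁-step i<phase₁ stage-t₀ stage-t₁ λ τx≡t₁ →
        x≢v (cong (label i) (τ-injective (trans τx≡t₁ (sym (τ-vertexAt t₁<n)))))

  label-phase₂ : ∀ {i} x → phase₁ ≤ i → label i x ≡ mergedLabel (i ∸ phase₁) (τ x)
  label-phase₂ x phase₁≤i = label-joined (joined-in-phase₂ x phase₁≤i)

  label-phase₂-suc : ∀ {i} x → phase₁ ≤ i → label (suc i) x ≡ mergedLabel (suc (i ∸ phase₁)) (τ x)
  label-phase₂-suc {i} x phase₁≤i =
    trans (label-phase₂ x (≤-trans phase₁≤i (n≤1+n i)))
          (cong (λ k → mergedLabel k (τ x)) (+-∸-assoc 1 phase₁≤i))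

  phase₂-length : ∀ {i} → phase₁ ≤ i → suc i < n → i ∸ phase₁ < chunk (pred n)
  phase₂-length {i} phase₁≤i i<n-1 = begin
    suc (i ∸ phase₁)   ≡⟨ +-∸-assoc 1 phase₁≤i ⟨
    suc i ∸ phase₁     ≤⟨ ∸-monoˡ-≤ phase₁ (suc[m]≤n⇒m≤pred[n] i<n-1) ⟩
    pred n ∸ phase₁    ≡⟨ m∸[m∸n]≡n (chunk≤ (pred n)) ⟩
    chunk (pred n)     ∎
    where open ≤-Reasoning

  phase₂-step : ∀ {i x} → phase₁ ≤ i → chunk (τ x) ≢ suc (i ∸ phase₁) → label (suc i) x ≡ label i x
  phase₂-step {i} {x} phase₁≤i c≢ with <-cmp (chunk (τ x)) (suc (i ∸ phase₁))
  ... | tri≈ _ c≡ _ = ⊥-elim (c≢ c≡)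
  ... | tri< c≤k _ _ = begin
    label (suc i) x                     ≡⟨ label-phase₂-suc x phase₁≤i ⟩
    mergedLabel (suc (i ∸ phase₁)) (τ x) ≡⟨ mergedLabel-in (≤-trans (≤-pred c≤k) (n≤1+n _)) ⟩
    0                                   ≡⟨ mergedLabel-in (≤-pred c≤k) ⟨
    mergedLabel (i ∸ phase₁) (τ x)      ≡⟨ label-phase₂ x phase₁≤i ⟨
    label i x                           ∎
    where open ≡-Reasoning
  ... | tri> _ _ 1+k<c = begin
    label (suc i) x                     ≡⟨ label-phase₂-suc x phase₁≤i ⟩
    mergedLabel (suc (i ∸ phase₁)) (τ x) ≡⟨ mergedLabel-out 1+k<c ⟩
    chunkStart (τ x)                    ≡⟨ mergedLabel-out (<-trans (n<1+n _) 1+k<c) ⟨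
    mergedLabel (i ∸ phase₁) (τ x)      ≡⟨ label-phase₂ x phase₁≤i ⟨
    label i x                           ∎
    where open ≡-Reasoning

  phase₂-merge : ∀ i → phase₁ ≤ i → suc i < n → MergeOf (partition i) (partition (suc i))
  phase₂-merge i phase₁≤i i<n-1 with chunk-crossing (pred n) (phase₂-length phase₁≤i i<n-1)
  ... | t₀ , t₀<n-1 , chunk-t₁ = relabel-merge (label i) (label (suc i)) u v u≢v into-u keep
    where
      k : ℕ
      k = i ∸ phase₁
      t₁<n : suc t₀ < n
      t₁<n = <pred⇒suc< t₀<n-1
      0<n : 0 < n
      0<n = ≤-<-trans z≤n t₁<n
      u v : Fin n
      u = vertexAt 0<n
      v = vertexAt t₁<n
      chunk-v : chunk (τ v) ≡ suc k
      chunk-v = trans (cong chunk (τ-vertexAt t₁<n)) chunk-t₁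
      label-u : label i u ≡ 0
      label-u = trans (label-phase₂ u phase₁≤i)
                      (mergedLabel-in (≤-trans (≤-reflexive (trans (cong chunk (τ-vertexAt 0<n)) chunk-zero)) z≤n))
      label-v : label i v ≡ chunkStart (τ v)
      label-v = trans (label-phase₂ v phase₁≤i) (mergedLabel-out (≤-reflexive (sym chunk-v)))
      u≢v : label i u ≢ label i v
      u≢v same = <-irrefl (trans (sym label-u) (trans same label-v))
                          (<-≤-trans (s≤s z≤n) (≤-trans (≤-reflexive (sym chunk-v)) (chunk≤chunkStart (τ v))))
      in-v : ∀ x → label i x ≡ label i v → chunk (τ x) ≡ suc k
      in-v x same with chunk (τ x) ≤? k
      ... | yes c≤k =
        ⊥-elim (u≢v (trans label-u (trans (sym (trans (label-phase₂ x phase₁≤i) (mergedLabel-in c≤k))) same)))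
      ... | no c≰k = trans (same-start⇒same-chunk (begin
        chunkStart (τ x)  ≡⟨ mergedLabel-out (≰⇒> c≰k) ⟨
        mergedLabel k (τ x) ≡⟨ label-phase₂ x phase₁≤i ⟨
        label i x         ≡⟨ same ⟩
        label i v         ≡⟨ label-v ⟩
        chunkStart (τ v)  ∎)) chunk-v
        where open ≡-Reasoning
      into-u : ∀ x → label i x ≡ label i v → label (suc i) x ≡ label i u
      into-u x same =
        trans (label-phase₂-suc x phase₁≤i) (trans (mergedLabel-in (≤-reflexive (in-v x same))) (sym label-u))
      keep : ∀ x → label i x ≢ label i v → label (suc i) x ≡ label i x
      keep x x≢v = phase₂-step phase₁≤i λ c≡ →
        x≢v (trans (label-phase₂ x phase₁≤i) (trans (mergedLabel-cong k (trans c≡ (sym chunk-v)))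
                                                (sym (label-phase₂ v phase₁≤i))))

  merge-step : ∀ i → suc i < n → MergeOf (partition i) (partition (suc i))
  merge-step i i<n-1 with suc i ≤? phase₁
  ... | yes i<phase₁ = phase₁-merge i i<phase₁
  ... | no i≮phase₁ = phase₂-merge i (≤-pred (≰⇒> i≮phase₁)) i<n-1

  contractionSequence : ContractionSequence n
  contractionSequence = record
    { seq      = λ i → partition (toℕ i)
    ; discrete = λ i i≡0 → subst (Discrete ∘ partition) (sym i≡0)
                   (sameLabel-discrete λ x y same →
                      τ-injective (trans (sym (label-zero x)) (trans same (label-zero y))))
    ; merges   = λ i j 1+i≡j → subst (MergeOf (partition (toℕ i)) ∘ partition) 1+i≡j
                   (merge-step (toℕ i) (subst (_< n) (sym 1+i≡j) (Finₚ.toℕ<n j)))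
    }

-- Width

module Width {n : ℕ} (G : Graph n) (σ : Permutation′ n) (d : ℕ) (later-degree : LaterDegreeAtMost G σ d)
             (C : Chunking) (len : ℕ → ℕ) (K : ℕ)
             (chunk<K : ∀ t → t < n → Chunking.chunk C t < K)
             (offset<len : ∀ t t′ → t < n → t′ < n →
                           Chunking.chunk C t′ ≡ Chunking.chunk C t → Chunking.offset C t′ < len t)
             (chunk+len≤K : ∀ t → t < n → Chunking.chunk C t + d * len t ≤ K) where
  open Chunking C
  open Contraction σ C

  joined-parts : ∀ i → count (λ w → isRep (partition i) w ∧ (stage (τ w) ≤ᵇ i)) ≤ K
  joined-parts i = count-below (chunk ∘ τ) (λ w _ → chunk<K (τ w) (τ<n w)) injective
    where
      injective : ∀ w w′ → T (isRep (partition i) w ∧ (stage (τ w) ≤ᵇ i)) →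
                  T (isRep (partition i) w′ ∧ (stage (τ w′) ≤ᵇ i)) → chunk (τ w) ≡ chunk (τ w′) → w ≡ w′
      injective w w′ hw hw′ c≡ with T-∧-elim (isRep (partition i) w) hw
                                  | T-∧-elim (isRep (partition i) w′) hw′
      ... | rep , joined | rep′ , joined′ =
        sameLabel-rep-unique rep rep′ (same-chunk⇒same-label (≤ᵇ⇒≤ _ _ joined) (≤ᵇ⇒≤ _ _ joined′) c≡)

  red-joined-only : ∀ i u → (∀ w → T (redEdge G (partition i) u w) → stage (τ w) ≤ i) →
                    redDeg G (partition i) u ≤ K
  red-joined-only i u only-joined = ≤-trans (count-mono joined) (joined-parts i)
    where
      joined : ∀ w → T (isRep (partition i) w ∧ redEdge G (partition i) u w) →
                     T (isRep (partition i) w ∧ (stage (τ w) ≤ᵇ i))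
      joined w h with T-∧-elim (isRep (partition i) w) h
      ... | rep , red = T-∧-intro rep (≤⇒≤ᵇ (only-joined w red))

  pending-red : ∀ {i u w} → i < stage (τ u) → T (redEdge G (partition i) u w) → stage (τ w) ≤ i
  pending-red {i} {u} {w} pending red with stage (τ w) ≤? i
  ... | yes joined = joined
  ... | no w-pending =
    ⊥-elim (singletons-not-red G (partition i) (singleton pending) (singleton (≰⇒> w-pending)) red)
    where
      singleton : ∀ {x} → i < stage (τ x) → ∀ a → T (partition i x a) → a ≡ x
      singleton pending a xa = pending-singleton pending (sym (sameLabel⇒≡ (label i) xa))

  module Building {i : ℕ} {u : Fin n} (i≤phase₁ : i ≤ phase₁) (u-joined : stage (τ u) ≤ i) where

    P : Partition n
    P = partition i

    member-chunk : ∀ {a} → T (P u a) → chunk (τ a) ≡ chunk (τ u)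
    member-chunk {a} ua = sym (same-label⇒same-chunk i≤phase₁ u-joined (joined-closed u-joined same) same)
      where
        same : label i u ≡ label i a
        same = sameLabel⇒≡ (label i) ua

    members : count (P u) ≤ len (τ u)
    members = count-below (offset ∘ τ) (λ a ua → offset<len (τ u) (τ a) (τ<n u) (τ<n a) (member-chunk ua))
      (λ a a′ ua ua′ o≡ → τ-injective (offset-injective (trans (member-chunk ua) (sym (member-chunk ua′))) o≡))

    laterNeighbour : Fin n → Fin n → Bool
    laterNeighbour a b = P u a ∧ (adj G b a ∧ (τ a <ᵇ τ b))

    reached : Fin n → Bool
    reached b = anyFin (λ a → laterNeighbour a b)

    reached-count : count reached ≤ d * len (τ u)
    reached-count = ≤-trans (count-⋃ {g = laterNeighbour} {p = P u} d per-member in-part) (*-monoʳ-≤ d members)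
      where
        per-member : ∀ a → count (laterNeighbour a) ≤ d
        per-member a =
          ≤-trans (count-mono {p = laterNeighbour a} (λ b h → proj₂ (T-∧-elim (P u a) h))) (later-degree a)
        in-part : ∀ a b → T (laterNeighbour a b) → T (P u a)
        in-part a b h = proj₁ (T-∧-elim (P u a) h)

    viaLater : Fin n → Bool
    viaLater w = isRep P w ∧ anyFin (λ b → P w b ∧ reached b)

    earlierChunk : Fin n → Bool
    earlierChunk w = isRep P w ∧ ((stage (τ w) ≤ᵇ i) ∧ (chunk (τ w) <ᵇ chunk (τ u)))

    viaLater-count : count viaLater ≤ count reached
    viaLater-count =
      count-injection (λ w h → proj₁ (witness w h)) (λ w h → proj₂ (proj₂ (witness w h))) injective
      where
        witness : ∀ w → T (viaLater w) → ∃ λ b → T (P w b) × T (reached b)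
        witness w h with anyFin-witness (proj₂ (T-∧-elim (isRep P w) h))
        ... | b , wb∧reached = b , T-∧-elim (P w b) wb∧reached
        injective : ∀ w w′ h h′ → proj₁ (witness w h) ≡ proj₁ (witness w′ h′) → w ≡ w′
        injective w w′ h h′ b≡ =
          sameLabel-rep-unique (proj₁ (T-∧-elim (isRep P w) h)) (proj₁ (T-∧-elim (isRep P w′) h′)) (begin
            label i w                       ≡⟨ sameLabel⇒≡ (label i) (proj₁ (proj₂ (witness w h))) ⟩
            label i (proj₁ (witness w h))   ≡⟨ cong (label i) b≡ ⟩
            label i (proj₁ (witness w′ h′)) ≡⟨ sameLabel⇒≡ (label i) (proj₁ (proj₂ (witness w′ h′))) ⟨
            label i w′                      ∎)
          where open ≡-Reasoning

    earlierChunk-count : count earlierChunk ≤ chunk (τ u)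
    earlierChunk-count = count-below (chunk ∘ τ) (λ w h → <ᵇ⇒< _ _ (proj₂ (parts w h))) injective
      where
        parts : ∀ w → T (earlierChunk w) → T (stage (τ w) ≤ᵇ i) × T (chunk (τ w) <ᵇ chunk (τ u))
        parts w h = T-∧-elim (stage (τ w) ≤ᵇ i) (proj₂ (T-∧-elim (isRep P w) h))
        injective : ∀ w w′ → T (earlierChunk w) → T (earlierChunk w′) → chunk (τ w) ≡ chunk (τ w′) → w ≡ w′
        injective w w′ h h′ c≡ =
          sameLabel-rep-unique (proj₁ (T-∧-elim (isRep P w) h)) (proj₁ (T-∧-elim (isRep P w′) h′))
            (same-chunk⇒same-label (≤ᵇ⇒≤ _ _ (proj₁ (parts w h))) (≤ᵇ⇒≤ _ _ (proj₁ (parts w′ h′))) c≡)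

    -- A red edge leaving the part of u is witnessed by an edge a b with a in the part: if b comes
    -- after a, it is one of the at most d later neighbours of a member, otherwise b lies in an
    -- earlier chunk.
    classify : ∀ w → T (isRep P w ∧ redEdge G P u w) → T (viaLater w) ⊎ T (earlierChunk w)
    classify w h with T-∧-elim (isRep P w) h
    ... | rep , red with redEdge-edge G P red
    ... | a , b , ua , wb , ab with <-cmp (τ a) (τ b)
    ... | tri< a<b _ _ = inj₁ (T-∧-intro rep (anyFin-intro b (T-∧-intro wb
            (anyFin-intro a (T-∧-intro ua (T-∧-intro (subst T (Graph.sym G a b) ab) (<⇒<ᵇ a<b)))))))
    ... | tri≈ _ a≡b _ = ⊥-elim (subst T (trans (cong (adj G a) (sym (τ-injective a≡b))) (Graph.irrefl G a)) ab)
    ... | tri> _ _ b<a =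
      inj₂ (T-∧-intro rep (T-∧-intro (≤⇒≤ᵇ w-joined) (<⇒<ᵇ (subst (_< chunk (τ u)) (sym w-chunk) b-earlier))))
      where
        a-joined : stage (τ a) ≤ i
        a-joined = joined-closed u-joined (sameLabel⇒≡ (label i) ua)
        b-joined : stage (τ b) ≤ i
        b-joined = ≤-trans (stage-mono (<⇒≤ b<a)) a-joined
        w-joined : stage (τ w) ≤ i
        w-joined = joined-closed b-joined (sym (sameLabel⇒≡ (label i) wb))
        w-chunk : chunk (τ w) ≡ chunk (τ b)
        w-chunk = same-label⇒same-chunk i≤phase₁ w-joined b-joined (sameLabel⇒≡ (label i) wb)
        b-earlier : chunk (τ b) < chunk (τ u)
        b-earlier = ≤∧≢⇒< (≤-trans (chunk-mono (<⇒≤ b<a)) (≤-reflexive (member-chunk ua))) λ c≡ →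
          redEdge-apart G P red (≡⇒sameLabel (label i) (begin
            label i u  ≡⟨ same-chunk⇒same-label u-joined b-joined (sym c≡) ⟩
            label i b  ≡⟨ sameLabel⇒≡ (label i) wb ⟨
            label i w  ∎))
          where open ≡-Reasoning

    redDeg≤K : redDeg G P u ≤ K
    redDeg≤K = begin
      redDeg G P u                          ≤⟨ count-∪ classify ⟩
      count viaLater + count earlierChunk   ≤⟨ +-mono-≤ (≤-trans viaLater-count reached-count) earlierChunk-count ⟩
      d * len (τ u) + chunk (τ u)           ≡⟨ +-comm _ (chunk (τ u)) ⟩
      chunk (τ u) + d * len (τ u)           ≤⟨ chunk+len≤K (τ u) (τ<n u) ⟩
      K                                     ∎
      where open ≤-Reasoning

  width : WidthAtMost G contractionSequence K
  width i u with stage (τ u) ≤? toℕ i | toℕ i ≤? phase₁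
  ... | yes u-joined | yes i≤phase₁ = Building.redDeg≤K i≤phase₁ u-joined
  ... | yes _ | no i≰phase₁ =
    red-joined-only (toℕ i) u (λ w _ → joined-in-phase₂ w (<⇒≤ (≰⇒> i≰phase₁)))
  ... | no u-pending | _ = red-joined-only (toℕ i) u (λ w → pending-red (≰⇒> u-pending))

-- The staircase chunking

descSum : ℕ → ℕ → ℕ
descSum m zero = 0
descSum m (suc a) = descSum m a + (m ∸ a)

descSum-mono : ∀ m {a a′} → a ≤ a′ → descSum m a ≤ descSum m a′
descSum-mono m = stepwise-mono (descSum m) (λ a → m≤m+n (descSum m a) (m ∸ a))

descSum-closed-form : ∀ m → 2 * descSum m m ≡ m * suc m
descSum-closed-form m = begin
  2 * descSum m m                           ≡⟨ +-identityʳ _ ⟨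
  2 * descSum m m + 0 * suc 0               ≡⟨ cong (λ x → 2 * descSum m m + x * suc x) (n∸n≡0 m) ⟨
  2 * descSum m m + (m ∸ m) * suc (m ∸ m)   ≡⟨ partial m ≤-refl ⟩
  m * suc m                                 ∎
  where
    open ≡-Reasoning
    add-round : ∀ S k → 2 * (S + suc k) + k * suc k ≡ 2 * S + suc k * suc (suc k)
    add-round = solve-∀
    partial : ∀ a → a ≤ m → 2 * descSum m a + (m ∸ a) * suc (m ∸ a) ≡ m * suc m
    partial zero _ = refl
    partial (suc a) a<m = begin
      2 * (descSum m a + (m ∸ a)) + k * suc k   ≡⟨ cong (λ x → 2 * (descSum m a + x) + k * suc k) m∸a≡1+k ⟩
      2 * (descSum m a + suc k) + k * suc k     ≡⟨ add-round (descSum m a) k ⟩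
      2 * descSum m a + suc k * suc (suc k)     ≡⟨ cong (λ x → 2 * descSum m a + x * suc x) m∸a≡1+k ⟨
      2 * descSum m a + (m ∸ a) * suc (m ∸ a)   ≡⟨ partial a (<⇒≤ a<m) ⟩
      m * suc m                                 ∎
      where
        open ≡-Reasoning
        k : ℕ
        k = m ∸ suc a
        m∸a≡1+k : m ∸ a ≡ suc k
        m∸a≡1+k = +-∸-assoc 1 a<m

n≤d*descSum : ∀ d₀ n → n ≤ suc d₀ * descSum n n
n≤d*descSum d₀ zero = z≤n
n≤d*descSum d₀ (suc n) =
  ≤-trans (descSum-mono (suc n) {1} {suc n} (s≤s z≤n)) (m≤m+n _ (d₀ * descSum (suc n) (suc n)))

module Staircase (d₀ m : ℕ) where

  d : ℕ
  d = suc d₀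

  -- Round a consists of d chunks of length m ∸ a; position ⟨ a , b , o ⟩ is the o-th vertex of
  -- the b-th of them, the chunk with index d·a + b.
  record Position : Set where
    constructor ⟨_,_,_⟩
    field
      round copy offset : ℕ
  open Position

  next : Position → Position
  next ⟨ a , b , o ⟩ =
    if m ∸ a ≤ᵇ suc o
    then (if d₀ ≤ᵇ b then ⟨ suc a , 0 , 0 ⟩ else ⟨ a , suc b , 0 ⟩)
    else ⟨ a , b , suc o ⟩

  position : ℕ → Position
  position zero = ⟨ 0 , 0 , 0 ⟩
  position (suc t) = next (position t)

  index : Position → ℕ
  index p = d * round p + copy p

  data NextCase (a b o : ℕ) : Set where
    same-chunk : suc o < m ∸ a → next ⟨ a , b , o ⟩ ≡ ⟨ a , b , suc o ⟩ → NextCase a b o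
    next-copy  : m ∸ a ≤ suc o → b < d₀ → next ⟨ a , b , o ⟩ ≡ ⟨ a , suc b , 0 ⟩ → NextCase a b o
    next-round : m ∸ a ≤ suc o → d₀ ≤ b → next ⟨ a , b , o ⟩ ≡ ⟨ suc a , 0 , 0 ⟩ → NextCase a b o

  next-case : ∀ a b o → NextCase a b o
  next-case a b o with m ∸ a ≤? suc o
  ... | no not-full = same-chunk (≰⇒> not-full) (if-≤ᵇ-no (≰⇒> not-full))
  ... | yes full with d₀ ≤? b
  ...   | yes last = next-round full last (trans (if-≤ᵇ-yes full) (if-≤ᵇ-yes last))
  ...   | no not-last = next-copy full (≰⇒> not-last) (trans (if-≤ᵇ-yes full) (if-≤ᵇ-no (≰⇒> not-last)))

  -- Only a lower bound on t: chunks of the rounds a ≥ m have length 0 but still occupy a position.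
  Valid : Position → ℕ → Set
  Valid ⟨ a , b , o ⟩ t = b ≤ d₀ × (o ≡ 0 ⊎ o < m ∸ a) × (d * descSum m a + b * (m ∸ a) + o ≤ t)

  valid-next : ∀ {t} p → Valid p t → Valid (next p) (suc t)
  valid-next {t} ⟨ a , b , o ⟩ (b≤ , o-ok , start≤t) with next-case a b o
  ... | same-chunk o<len eq rewrite eq =
        b≤ , inj₂ o<len , ≤-trans (≤-reflexive (+-suc _ o)) (s≤s start≤t)
  ... | next-copy full b<d₀ eq rewrite eq = b<d₀ , inj₁ refl , (begin
        d * descSum m a + suc b * (m ∸ a) + 0   ≡⟨ next-copy-start d (descSum m a) (m ∸ a) b ⟩
        d * descSum m a + b * (m ∸ a) + (m ∸ a) ≤⟨ +-monoʳ-≤ _ full ⟩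
        d * descSum m a + b * (m ∸ a) + suc o   ≡⟨ +-suc _ o ⟩
        suc (d * descSum m a + b * (m ∸ a) + o) ≤⟨ s≤s start≤t ⟩
        suc t                                    ∎)
    where
      open ≤-Reasoning
      next-copy-start : ∀ d S L b → d * S + suc b * L + 0 ≡ d * S + b * L + L
      next-copy-start = solve-∀
  ... | next-round full d₀≤b eq rewrite eq = z≤n , inj₁ refl , (begin
        d * descSum m (suc a) + 0 * (m ∸ suc a) + 0 ≡⟨ next-round-start d₀ (descSum m a) (m ∸ a) (m ∸ suc a) ⟩
        d * descSum m a + d₀ * (m ∸ a) + (m ∸ a) ≤⟨ +-mono-≤ (+-monoʳ-≤ _ (*-monoˡ-≤ (m ∸ a) d₀≤b)) full ⟩
        d * descSum m a + b * (m ∸ a) + suc o   ≡⟨ +-suc _ o ⟩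
        suc (d * descSum m a + b * (m ∸ a) + o) ≤⟨ s≤s start≤t ⟩
        suc t                                    ∎)
    where
      open ≤-Reasoning
      next-round-start : ∀ d₀ S L L′ → suc d₀ * (S + L) + 0 * L′ + 0 ≡ suc d₀ * S + d₀ * L + L
      next-round-start = solve-∀

  valid : ∀ t → Valid (position t) t
  valid zero = z≤n , inj₁ refl , ≤-reflexive (trans (+-identityʳ _) (trans (+-identityʳ _) (*-zeroʳ d)))
  valid (suc t) = valid-next (position t) (valid t)

  copy≤ : ∀ t → copy (position t) ≤ d₀
  copy≤ t = proj₁ (valid t)

  next-index : ∀ p → copy p ≤ d₀ → (index (next p) ≡ suc (index p) × offset (next p) ≡ 0)
                                  ⊎ (index (next p) ≡ index p × offset (next p) ≡ suc (offset p))
  next-index ⟨ a , b , o ⟩ b≤d₀ with next-case a b o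
  ... | same-chunk _ eq rewrite eq = inj₂ (refl , refl)
  ... | next-copy _ _ eq rewrite eq = inj₁ (+-suc (d * a) b , refl)
  ... | next-round _ d₀≤b eq rewrite eq | ≤-antisym b≤d₀ d₀≤b = inj₁ (last-copy d₀ a , refl)
    where
      last-copy : ∀ d₀ a → suc d₀ * suc a + 0 ≡ suc (suc d₀ * a + d₀)
      last-copy = solve-∀

  chunking : Chunking
  chunking = record
    { chunk       = index ∘ position
    ; offset      = offset ∘ position
    ; chunk-zero  = trans (+-identityʳ (d * 0)) (*-zeroʳ d)
    ; offset-zero = refl
    ; step        = λ t → next-index (position t) (copy≤ t)
    }

  index-< : ∀ {a a′ b b′} → a < a′ → b ≤ d₀ → d * a + b < d * a′ + b′
  index-< {a} {a′} {b} {b′} a<a′ b≤d₀ = begin-strict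
    d * a + b         ≤⟨ +-monoʳ-≤ (d * a) b≤d₀ ⟩
    d * a + d₀        <⟨ +-monoʳ-< (d * a) (n<1+n d₀) ⟩
    d * a + d         ≡⟨ +-comm (d * a) d ⟩
    d + d * a         ≡⟨ *-suc d a ⟨
    d * suc a         ≤⟨ *-monoʳ-≤ d a<a′ ⟩
    d * a′            ≤⟨ m≤m+n (d * a′) b′ ⟩
    d * a′ + b′       ∎
    where open ≤-Reasoning

  index⇒round : ∀ t t′ → index (position t) ≡ index (position t′) →
                round (position t) ≡ round (position t′)
  index⇒round t t′ same with <-cmp (round (position t)) (round (position t′))
  ... | tri< r<r′ _ _ = ⊥-elim (<-irrefl same (index-< r<r′ (copy≤ t)))
  ... | tri≈ _ r≡r′ _ = r≡r′
  ... | tri> _ _ r′<r = ⊥-elim (<-irrefl (sym same) (index-< r′<r (copy≤ t′)))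

  module _ {n : ℕ} (fits : n ≤ d * descSum m m) {t : ℕ} (t<n : t < n) where

    private
      a b : ℕ
      a = round (position t)
      b = copy (position t)

    round<m : a < m
    round<m with a <? m
    ... | yes a<m = a<m
    ... | no a≮m = ⊥-elim (<⇒≱ t<n (begin
      n                                                    ≤⟨ fits ⟩
      d * descSum m m                                      ≤⟨ *-monoʳ-≤ d (descSum-mono m (≮⇒≥ a≮m)) ⟩
      d * descSum m a                                      ≤⟨ m≤m+n _ _ ⟩
      d * descSum m a + b * (m ∸ a)                        ≤⟨ m≤m+n _ _ ⟩
      d * descSum m a + b * (m ∸ a) + offset (position t)  ≤⟨ proj₂ (proj₂ (valid t)) ⟩
      t                                                    ∎))
      where open ≤-Reasoning

    offset<length : offset (position t) < m ∸ a
    offset<length with proj₁ (proj₂ (valid t))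
    ... | inj₁ o≡0 = subst (_< m ∸ a) (sym o≡0) (m<n⇒0<n∸m round<m)
    ... | inj₂ o<len = o<len

    chunk+length≤ : index (position t) + d * (m ∸ a) ≤ d * m + d₀
    chunk+length≤ = begin
      d * a + b + d * (m ∸ a)   ≡⟨ +-comm (d * a + b) _ ⟩
      d * (m ∸ a) + (d * a + b) ≡⟨ +-assoc (d * (m ∸ a)) (d * a) b ⟨
      d * (m ∸ a) + d * a + b   ≡⟨ cong (_+ b) (*-distribˡ-+ d (m ∸ a) a) ⟨
      d * (m ∸ a + a) + b       ≡⟨ cong (λ x → d * x + b) (m∸n+n≡m (<⇒≤ round<m)) ⟩
      d * m + b                 ≤⟨ +-monoʳ-≤ (d * m) (copy≤ t) ⟩
      d * m + d₀                ∎
      where open ≤-Reasoning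

    chunk<width : index (position t) < d * m + d₀
    chunk<width = <-≤-trans (m<m+n _ positive) chunk+length≤
      where
        positive : 0 < d * (m ∸ a)
        positive = <-≤-trans (s≤s z≤n)
                     (≤-trans (≤-reflexive (sym (*-identityʳ d))) (*-monoʳ-≤ d (m<n⇒0<n∸m round<m)))

  staircase-width : ∀ {n} (G : Graph n) (σ : Permutation′ n) → LaterDegreeAtMost G σ d →
                    n ≤ d * descSum m m → WidthAtMost G (Contraction.contractionSequence σ chunking) (d * m + d₀)
  staircase-width G σ later fits =
    Width.width G σ d later chunking (λ t → m ∸ round (position t)) (d * m + d₀)
      (λ t t<n → chunk<width fits t<n)
      (λ t t′ t<n t′<n same →
         subst (λ r → offset (position t′) < m ∸ r) (index⇒round t′ t same) (offset<length fits t′<n))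
      (λ t t<n → chunk+length≤ fits t<n)

staircase-bound : ∀ d₀ n m → (m ≡ 0 ⊎ suc d₀ * descSum (pred m) (pred m) < n) →
                  ((suc d₀ * m + d₀) ∸ 2 * suc d₀) ^ 2 ≤ 2 * suc d₀ * n
staircase-bound d₀ n zero _ = ≤-trans (≤-reflexive (cong (_^ 2) (m≤n⇒m∸n≡0 small))) z≤n
  where
    small : suc d₀ * 0 + d₀ ≤ 2 * suc d₀
    small = ≤-trans (≤-reflexive (cong (_+ d₀) (*-zeroʳ (suc d₀))))
                    (≤-trans (n≤1+n d₀) (m≤m+n (suc d₀) _))
staircase-bound d₀ n (suc m) (inj₂ below) = begin
  (d * suc m + d₀ ∸ 2 * d) ^ 2    ≤⟨ ^-monoˡ-≤ 2 (m≤n+o⇒m∸n≤o _ (2 * d) (<⇒≤ (≤-reflexive (overshoot d₀ m)))) ⟩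
  (d * m) ^ 2                     ≡⟨ square d m ⟩
  d * d * (m * m)                 ≤⟨ *-monoʳ-≤ (d * d) (*-monoʳ-≤ m (n≤1+n m)) ⟩
  d * d * (m * suc m)             ≡⟨ cong (d * d *_) (descSum-closed-form m) ⟨
  d * d * (2 * descSum m m)       ≡⟨ regroup d (descSum m m) ⟩
  2 * d * (d * descSum m m)       ≤⟨ *-monoʳ-≤ (2 * d) (<⇒≤ below) ⟩
  2 * d * n                       ∎
  where
    open ≤-Reasoning
    d : ℕ
    d = suc d₀
    overshoot : ∀ d₀ m → suc (suc d₀ * suc m + d₀) ≡ 2 * suc d₀ + suc d₀ * m
    overshoot = solve-∀
    square : ∀ d m → d * m * (d * m * 1) ≡ d * d * (m * m)
    square = solve-∀
    regroup : ∀ d S → d * d * (2 * S) ≡ 2 * d * (d * S)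
    regroup = solve-∀

theorem3p12 : (d n : ℕ) (G : Graph n) → Degenerate d G →
    Σ ℕ λ k → TwwAtMost G k × ((k ∸ 2 * d) ^ 2 ≤ 2 * d * n)
theorem3p12 zero n G degenerate@(π , _) =
  0 , (S , edgeless-width G (degenerate-0⇒edgeless G degenerate) S) , z≤n
  where
    S : ContractionSequence n
    S = Contraction.contractionSequence π singletonChunking
theorem3p12 (suc d₀) n G (π , deg)
  with descend-to-boundary (λ m → n ≤? suc d₀ * descSum m m) n (n≤d*descSum d₀ n)
... | m , fits , boundary = suc d₀ * m + d₀ , (S , width) , staircase-bound d₀ n m (map₂ ≰⇒> boundary)
  where
    σ : Permutation′ n
    σ = π ∘ₚ reverse
    S : ContractionSequence n
    S = Contraction.contractionSequence σ (Staircase.chunking d₀ m)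
    width : WidthAtMost G S (suc d₀ * m + d₀)
    width = Staircase.staircase-width d₀ m G σ (reverse-later-degree G π deg) fits
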